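{- Let $p$ be a prime, $r \geq 1$ an integer, and $1 \leq a_1 \leq \dots \leq a_r$ integers, and let $G \simeq C_{p^{a_1}} \oplus \cdots \oplus C_{p^{a_r}}$. Let $\delta$ be an integer with $0 \leq \delta \leq \mathsf{d}(G)-1$ and let $j_0=\min\{i \in \{1,\dots,r\} : a_i=a_r\}$. Then $$\Gamma_{\delta}(G) \leq \max\left(0,(r-j_0+1)\left(p^{a_r}-1\right)-\delta-f(\delta)\right),$$ where $$f(\delta)=\min\left(\left\lfloor \frac{\delta}{p-1} \right\rfloor,(r-j_0+1)\left(p^{a_r-1}-1\right)\right).$$
   Context: $C_n$ denotes the cyclic group of order $n$. A sequence in a finite abelian group $G$ is a finite unordered list of elements of $G$ with repetition allowed; its length is the number of terms counted with multiplicity. A sequence is zero-sumfree if no nonempty subsequence has sum $0$. $\mathsf{d}(G)$ denotes the maximal length of a zero-sumfree sequence in $G$ (for the group above it equals $\sum_{i=1}^r (p^{a_i}-1)$). An element has maximal order if its order equals $\exp(G)$. For an integer $0 \le \delta \le \mathsf{d}(G)-1$, $\Gamma_\delta(G)$ is the minimum, over all zero-sumfree sequences $S$ in $G$ with $|S| \geq \mathsf{d}(G)-\delta$, of the number of terms of $S$ (with multiplicity) of maximal order. -}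

module Defs where

open import Data.Nat using (ℕ; zero; suc; _+_; _*_; _∸_; _^_; _≤_; _<_; _⊓_; NonZero)
open import Data.Nat.Properties using (≤-refl)
open import Data.Nat.Divisibility using (_∣_; _∣?_)
open import Data.Nat.DivMod using (_/_)
open import Data.Nat.Primality using (Prime)
open import Data.Nat.Base using (NonTrivial; nonTrivial; nonTrivial⇒n>1; >-nonZero)
open import Data.Fin using (Fin; toℕ; fromℕ)
open import Data.Fin.Properties using (all?)
open import Data.List using (List; []; _∷_; map; length; filter)
open import Data.Nat.ListAction using (sum)
open import Data.List.Relation.Binary.Sublist.Propositional using (_⊆_)
open import Data.Product using (Σ; _×_; ∃)
open import Relation.Nullary using (¬_; Dec)
open import Relation.Nullary.Decidable using (_→-dec_; ¬?)
open import Relation.Binary.PropositionalEquality using (_≡_; _≢_)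

-- The group G = C_{p^{a_1}} ⊕ ... ⊕ C_{p^{a_r}} is modelled with elements
-- g : Fin r → ℕ (coordinate i read modulo p ^ a i); a *canonical* element
-- has every coordinate g i < p ^ a i.

Elem : ℕ → Set
Elem r = Fin r → ℕ

InG : ∀ {r} (p : ℕ) (a : Fin r → ℕ) → Elem r → Set
InG p a g = ∀ i → g i < p ^ a i

IsZero : ∀ {r} (p : ℕ) (a : Fin r → ℕ) → Elem r → Set
IsZero p a g = ∀ i → p ^ a i ∣ g i

-- sum of a sequence (coordinatewise, over ℕ; reduced only when tested)
seqSum : ∀ {r} → List (Elem r) → Elem r
seqSum T i = sum (map (λ g → g i) T)

ZeroSumFree : ∀ {r} (p : ℕ) (a : Fin r → ℕ) → List (Elem r) → Set
ZeroSumFree p a S = ∀ (T : List _) → T ⊆ S → T ≢ [] → ¬ IsZero p a (seqSum T)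

scale : ∀ {r} → ℕ → Elem r → Elem r
scale k g i = k * g i

HasOrder : ∀ {r} (p : ℕ) (a : Fin r → ℕ) (E : ℕ) → Elem r → Set
HasOrder p a E g =
  IsZero p a (scale E g) × (∀ (k : Fin E) → 0 < toℕ k → ¬ IsZero p a (scale (toℕ k) g))

isZero? : ∀ {r} (p : ℕ) (a : Fin r → ℕ) (g : Elem r) → Dec (IsZero p a g)
isZero? p a g = all? (λ i → p ^ a i ∣? g i)

hasOrder? : ∀ {r} (p : ℕ) (a : Fin r → ℕ) (E : ℕ) (g : Elem r) → Dec (HasOrder p a E g)
hasOrder? p a E g = isZero? p a (scale E g) Relation.Nullary.×-dec
  all? (λ k → Data.Nat._<?_ 0 (toℕ k) →-dec ¬? (isZero? p a (scale (toℕ k) g)))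
  where import Relation.Nullary; import Data.Nat

-- exponent of G (a is nondecreasing, so the largest exponent is a_r);
-- here r = suc n and the last index is fromℕ n
expG : ∀ {n} (p : ℕ) (a : Fin (suc n) → ℕ) → ℕ
expG {n} p a = p ^ a (fromℕ n)

numMaxOrder : ∀ {n} (p : ℕ) (a : Fin (suc n) → ℕ) → List (Elem (suc n)) → ℕ
numMaxOrder p a S = length (filter (hasOrder? p a (expG p a)) S)

sumFin : ∀ {r} → (Fin r → ℕ) → ℕ
sumFin {zero} f = 0
sumFin {suc r} f = f Data.Fin.zero + sumFin (λ i → f (Data.Fin.suc i))
  where import Data.Fin

davenport : ∀ {r} (p : ℕ) (a : Fin r → ℕ) → ℕ
davenport p a = sumFin (λ i → p ^ a i ∸ 1)

-- Γ_δ(G) ≤ M, unfolding the minimum: some zero-sumfree S with |S| ≥ d(G) - δ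
-- has at most M terms of maximal order.
ΓLe : ∀ {n} (p : ℕ) (a : Fin (suc n) → ℕ) (δ M : ℕ) → Set
ΓLe p a δ M = Σ (List (Elem _)) λ S →
  (∀ {g} → Data.List.Membership.Propositional._∈_ g S → InG p a g)
  × ZeroSumFree p a S × (davenport p a ∸ δ ≤ length S) × (numMaxOrder p a S ≤ M)
  where import Data.List.Membership.Propositional

prime-1-nonZero : ∀ {p} → Prime p → NonZero (p ∸ 1)
prime-1-nonZero {suc (suc q)} _ = _

divPred : ∀ {p} → Prime p → ℕ → ℕ
divPred {p} pr δ = _/_ δ (p ∸ 1) {{prime-1-nonZero pr}}

{-# OPTIONS --safe #-}
module Submission where

-- With w = p − 1, q = p^(a_r − 1) and k = r − j0 + 1 the number of coordinates of maximal
-- exponent, the witness consists of x_i copies of e_i and y_i copies of p·e_i in each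
-- coordinate i.  If x_i + p·y_i < p^(a_i) for all i, the sum of a nonempty subsequence has a
-- coordinate strictly between 0 and its modulus, so the sequence is zero-sumfree; only the e_i
-- with a_i = a_r have maximal order.  Starting from x_i = p^(a_i) − 1 (length d(G)), the length
-- deficit δ is spent in the top coordinates: replacing p copies of e_i by one p·e_i costs w in
-- length and p terms of maximal order, and is done f = min(⌊δ/w⌋, k(q − 1)) times; the rest
-- R = δ − w·f of the deficit is spent by deleting copies of e_i, at most w per coordinate.
-- If R fits, exactly δ + f terms of maximal order are lost; otherwise the top coordinates
-- are exhausted and none remain.

open import Defs
open import Data.Nat using (ℕ; suc; _+_; _*_; _∸_; _^_; _≤_; _⊓_)
open import Data.Nat.Primality using (Prime)
open import Data.Fin using (Fin; toℕ; fromℕ)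
open import Relation.Binary.PropositionalEquality using (_≡_)

open import Data.Nat.Base using (zero; z≤n; s≤s; _<_; NonZero; >-nonZero)
open import Data.Nat.Properties
open import Data.Nat.DivMod using (_/_; _%_; m%n≡m∸m/n*n; m%n<n; m/n*n≤m)
open import Data.Nat.Divisibility using (_∣_; ∣⇒≤; _∣0; 1∣_; *-monoʳ-∣)
open import Data.Nat.Primality using (¬prime[0]; ¬prime[1])
open import Data.Nat.ListAction using (sum)
open import Data.Nat.ListAction.Properties using (sum-++)
open import Data.Nat.Tactic.RingSolver using (solve-∀)
open import Data.Fin.Base using (fromℕ<) renaming (zero to fzero; suc to fsuc)
open import Data.Fin.Properties using (≤fromℕ; toℕ-fromℕ<; toℕ<n)
open import Data.List.Base using (List; []; _∷_; _++_; replicate; length; map; filter; concat; tabulate)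
open import Data.List.Properties using (length-++; length-replicate; map-++; filter-++; filter-none; length-filter)
open import Data.List.Relation.Unary.All using (All; _∷_)
open import Data.List.Relation.Unary.All.Properties using (++⁺; concat⁺; tabulate⁺; replicate⁺)
open import Data.List.Relation.Unary.Any using (here; there)
open import Data.List.Membership.Propositional using (_∈_)
open import Data.List.Relation.Binary.Sublist.Propositional using (_⊆_; []; _∷ʳ_; _∷_)
open import Data.List.Relation.Binary.Sublist.Propositional.Properties using (All-resp-⊆)
open import Algebra.Properties.Semiring.Sum +-*-semiring
  using (∑-distrib-+; *-distribʳ-sum; *-distribˡ-sum; sum-replicate-zero; sum-cong-≗) renaming (sum to ∑)
open import Data.Product using (_×_; _,_; ∃)
open import Data.Sum using (_⊎_; inj₁; inj₂)
open import Data.Empty using (⊥-elim)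
open import Function using (_∘_)
open import Relation.Unary using (Decidable)
open import Relation.Nullary using (¬_; yes; no)
open import Relation.Binary.PropositionalEquality using (refl; sym; trans; cong; cong₂; subst; module ≡-Reasoning)

sumFin≡∑ : ∀ {m} (f : Fin m → ℕ) → sumFin f ≡ ∑ f
sumFin≡∑ {zero} f = refl
sumFin≡∑ {suc m} f = cong (f fzero +_) (sumFin≡∑ (f ∘ fsuc))

∑-mono-≤ : ∀ {m} {f g : Fin m → ℕ} → (∀ i → f i ≤ g i) → ∑ f ≤ ∑ g
∑-mono-≤ {zero} f≤g = z≤n
∑-mono-≤ {suc m} f≤g = +-mono-≤ (f≤g fzero) (∑-mono-≤ (f≤g ∘ fsuc))

𝟙[_≤_] : ℕ → ℕ → ℕ
𝟙[ zero ≤ x ] = 1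
𝟙[ suc t ≤ zero ] = 0
𝟙[ suc t ≤ suc x ] = 𝟙[ t ≤ x ]

𝟙≤-cases : ∀ t x → (𝟙[ t ≤ x ] ≡ 1 × t ≤ x) ⊎ (𝟙[ t ≤ x ] ≡ 0 × x < t)
𝟙≤-cases zero x = inj₁ (refl , z≤n)
𝟙≤-cases (suc t) zero = inj₂ (refl , s≤s z≤n)
𝟙≤-cases (suc t) (suc x) with 𝟙≤-cases t x
... | inj₁ (e , t≤x) = inj₁ (e , s≤s t≤x)
... | inj₂ (e , x<t) = inj₂ (e , s≤s x<t)

∑-𝟙≤ : ∀ m t → ∑ {m} (λ i → 𝟙[ t ≤ toℕ i ]) ≡ m ∸ t
∑-𝟙≤ zero zero = refl
∑-𝟙≤ zero (suc t) = refl
∑-𝟙≤ (suc m) zero = cong suc (∑-𝟙≤ m zero)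
∑-𝟙≤ (suc m) (suc t) = ∑-𝟙≤ m t

fill : ∀ {m} → (Fin m → ℕ) → ℕ → Fin m → ℕ
fill cap t fzero = cap fzero ⊓ t
fill cap t (fsuc i) = fill (cap ∘ fsuc) (t ∸ cap fzero) i

fill-≤ : ∀ {m} (cap : Fin m → ℕ) t i → fill cap t i ≤ cap i
fill-≤ cap t fzero = m⊓n≤m _ _
fill-≤ cap t (fsuc i) = fill-≤ (cap ∘ fsuc) (t ∸ cap fzero) i

∑-fill : ∀ {m} (cap : Fin m → ℕ) t → ∑ (fill cap t) ≡ t ⊓ ∑ cap
∑-fill {zero} cap t = sym (⊓-zeroʳ t)
∑-fill {suc m} cap t rewrite ∑-fill (cap ∘ fsuc) (t ∸ cap fzero) with ≤-total (cap fzero) t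
... | inj₁ c≤t rewrite m≤n⇒m⊓n≡m c≤t = begin
  c + (t ∸ c) ⊓ ∑ (cap ∘ fsuc)         ≡⟨ +-distribˡ-⊓ c _ _ ⟩
  (c + (t ∸ c)) ⊓ (c + ∑ (cap ∘ fsuc)) ≡⟨ cong (_⊓ (c + ∑ (cap ∘ fsuc))) (m+[n∸m]≡n c≤t) ⟩
  t ⊓ (c + ∑ (cap ∘ fsuc))             ∎
  where open ≡-Reasoning
        c = cap fzero
... | inj₂ t≤c rewrite m≥n⇒m⊓n≡n t≤c | m≤n⇒m∸n≡0 t≤c | ⊓-zeroˡ (∑ (cap ∘ fsuc)) =
  trans (+-identityʳ t) (sym (m≤n⇒m⊓n≡m (≤-trans t≤c (m≤m+n _ _))))

infix 5 _·e_
_·e_ : ∀ {r} → ℕ → Fin r → Elem r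
(c ·e fzero) fzero = c
(c ·e fzero) (fsuc j) = 0
(c ·e fsuc i) fzero = 0
(c ·e fsuc i) (fsuc j) = (c ·e i) j

·e-self : ∀ {r} c (i : Fin r) → (c ·e i) i ≡ c
·e-self c fzero = refl
·e-self c (fsuc i) = ·e-self c i

*-·e : ∀ {r} m c (i j : Fin r) → m * (c ·e i) j ≡ (m * c ·e i) j
*-·e m c fzero fzero = refl
*-·e m c fzero (fsuc j) = *-zeroʳ m
*-·e m c (fsuc i) fzero = *-zeroʳ m
*-·e m c (fsuc i) (fsuc j) = *-·e m c i j

+-·e : ∀ {r} b c (i j : Fin r) → (b ·e i) j + (c ·e i) j ≡ (b + c ·e i) j
+-·e b c fzero fzero = refl
+-·e b c fzero (fsuc j) = refl
+-·e b c (fsuc i) fzero = refl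
+-·e b c (fsuc i) (fsuc j) = +-·e b c i j

∑-·e : ∀ {r} (v : Fin r → ℕ) j → ∑ (λ i → (v i ·e i) j) ≡ v j
∑-·e {suc r} v fzero = trans (cong (v fzero +_) (sum-replicate-zero r)) (+-identityʳ (v fzero))
∑-·e v (fsuc j) = ∑-·e (v ∘ fsuc) j

·e-IsZero : ∀ {r} p (a : Fin r → ℕ) {m} i → p ^ a i ∣ m → IsZero p a (m ·e i)
·e-IsZero p a fzero dvd fzero = dvd
·e-IsZero p a fzero dvd (fsuc j) = _ ∣0
·e-IsZero p a (fsuc i) dvd fzero = _ ∣0
·e-IsZero p a (fsuc i) dvd (fsuc j) = ·e-IsZero p (a ∘ fsuc) i dvd j

concat-tabulate-additive : ∀ {X : Set} (F : List X → ℕ) → F [] ≡ 0 →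
  (∀ xs ys → F (xs ++ ys) ≡ F xs + F ys) →
  ∀ {m} (B : Fin m → List X) → F (concat (tabulate B)) ≡ ∑ (F ∘ B)
concat-tabulate-additive F F[] F++ {zero} B = F[]
concat-tabulate-additive F F[] F++ {suc m} B =
  trans (F++ (B fzero) _) (cong (F (B fzero) +_) (concat-tabulate-additive F F[] F++ (B ∘ fsuc)))

module _ {r : ℕ} where

  seqSum-++ : ∀ (xs ys : List (Elem r)) j → seqSum (xs ++ ys) j ≡ seqSum xs j + seqSum ys j
  seqSum-++ xs ys j = trans (cong sum (map-++ (λ g → g j) xs ys)) (sum-++ (map (λ g → g j) xs) _)

  seqSum-replicate : ∀ m (g : Elem r) j → seqSum (replicate m g) j ≡ m * g j
  seqSum-replicate zero g j = refl
  seqSum-replicate (suc m) g j = cong (g j +_) (seqSum-replicate m g j)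

  length-filter-++ : ∀ {P : Elem r → Set} (P? : Decidable P) xs ys →
    length (filter P? (xs ++ ys)) ≡ length (filter P? xs) + length (filter P? ys)
  length-filter-++ P? xs ys = trans (cong length (filter-++ P? xs ys)) (length-++ (filter P? xs))

  ∈⇒≤seqSum : ∀ {g : Elem r} {S} j → g ∈ S → g j ≤ seqSum S j
  ∈⇒≤seqSum j (here refl) = m≤m+n _ _
  ∈⇒≤seqSum {S = h ∷ S} j (there g∈S) = ≤-trans (∈⇒≤seqSum j g∈S) (m≤n+m _ (h j))

  seqSum-mono-⊆ : ∀ {T S : List (Elem r)} j → T ⊆ S → seqSum T j ≤ seqSum S j
  seqSum-mono-⊆ j [] = z≤n
  seqSum-mono-⊆ j (h ∷ʳ T⊆S) = ≤-trans (seqSum-mono-⊆ j T⊆S) (m≤n+m _ (h j))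
  seqSum-mono-⊆ j (refl ∷ T⊆S) = +-monoʳ-≤ _ (seqSum-mono-⊆ j T⊆S)

  HasPositiveCoordinate : Elem r → Set
  HasPositiveCoordinate g = ∃ λ j → 0 < g j

  positive-bounded⇒ZeroSumFree : ∀ p a {S : List (Elem r)} → All HasPositiveCoordinate S →
    (∀ j → seqSum S j < p ^ a j) → ZeroSumFree p a S
  positive-bounded⇒ZeroSumFree p a positive bounded [] T⊆S T≢[] _ = T≢[] refl
  positive-bounded⇒ZeroSumFree p a positive bounded (g ∷ T) T⊆S _ zero-sum with All-resp-⊆ T⊆S positive
  ... | (j , 0<gj) ∷ _ = <⇒≱ (≤-<-trans (seqSum-mono-⊆ j T⊆S) (bounded j))
      (∣⇒≤ {{>-nonZero (≤-trans 0<gj (m≤m+n _ _))}} (zero-sum j))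

  annihilated⇒¬HasOrder : ∀ p a E {g : Elem r} {m} → 0 < m → m < E →
    IsZero p a (scale m g) → ¬ HasOrder p a E g
  annihilated⇒¬HasOrder p a E {g} 0<m m<E zero-mult (_ , lower-mults-nonzero) =
    lower-mults-nonzero (fromℕ< m<E)
      (subst (0 <_) (sym (toℕ-fromℕ< m<E)) 0<m)
      (subst (λ t → IsZero p a (scale t g)) (sym (toℕ-fromℕ< m<E)) zero-mult)

^-monoʳ-∣ : ∀ m {u v} → u ≤ v → m ^ u ∣ m ^ v
^-monoʳ-∣ m {v = v} z≤n = 1∣ (m ^ v)
^-monoʳ-∣ m (s≤s u≤v) = *-monoʳ-∣ m (^-monoʳ-∣ m u≤v)

^-pred : ∀ m {A} → 1 ≤ A → m ^ (A ∸ 1) * m ≡ m ^ A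
^-pred m (s≤s _) = *-comm _ m

·e-¬HasOrder : ∀ {r p} (a : Fin r → ℕ) {A c} i → 1 < p → 1 ≤ A →
  p ^ a i ∣ p ^ (A ∸ 1) * c → ¬ HasOrder p a (p ^ A) (c ·e i)
·e-¬HasOrder {p = p@(suc (suc _))} a {A} {c} i (s≤s (s≤s _)) 1≤A dvd =
  annihilated⇒¬HasOrder p a (p ^ A) (m^n>0 p (A ∸ 1)) q<p^A q-multiple-zero
  where
  q = p ^ (A ∸ 1)
  q<p^A : q < p ^ A
  q<p^A = subst (q <_) (^-pred p 1≤A) (m<m*n q p {{m^n≢0 p (A ∸ 1)}} (s≤s (s≤s z≤n)))
  q-multiple-zero : IsZero p a (scale q (c ·e i))
  q-multiple-zero j = subst (p ^ a j ∣_) (sym (*-·e q c i j)) (·e-IsZero p a i dvd j)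

module _ {r : ℕ} (p : ℕ) (x y : Fin r → ℕ) where

  basisBlock : Fin r → List (Elem r)
  basisBlock i = replicate (x i) (1 ·e i) ++ replicate (y i) (p ·e i)

  basisSeq : List (Elem r)
  basisSeq = concat (tabulate basisBlock)

  length-basisSeq : length basisSeq ≡ ∑ (λ i → x i + y i)
  length-basisSeq = trans (concat-tabulate-additive length refl (λ xs ys → length-++ xs) basisBlock)
    (sum-cong-≗ λ i → trans (length-++ (replicate (x i) (1 ·e i)))
                            (cong₂ _+_ (length-replicate (x i)) (length-replicate (y i))))

  seqSum-basisSeq : ∀ j → seqSum basisSeq j ≡ x j + y j * p
  seqSum-basisSeq j = begin
    seqSum basisSeq j                       ≡⟨ concat-tabulate-additive (λ T → seqSum T j) refl
                                                 (λ xs ys → seqSum-++ xs ys j) basisBlock ⟩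
    ∑ (λ i → seqSum (basisBlock i) j)       ≡⟨ sum-cong-≗ blockSum ⟩
    ∑ (λ i → (x i * 1 + y i * p ·e i) j)    ≡⟨ ∑-·e (λ i → x i * 1 + y i * p) j ⟩
    x j * 1 + y j * p                       ≡⟨ cong (_+ y j * p) (*-identityʳ (x j)) ⟩
    x j + y j * p                           ∎
    where
    open ≡-Reasoning
    blockSum : ∀ i → seqSum (basisBlock i) j ≡ (x i * 1 + y i * p ·e i) j
    blockSum i = begin
      seqSum (basisBlock i) j                  ≡⟨ seqSum-++ (replicate (x i) (1 ·e i)) _ j ⟩
      seqSum (replicate (x i) (1 ·e i)) j + seqSum (replicate (y i) (p ·e i)) j
        ≡⟨ cong₂ _+_ (seqSum-replicate (x i) (1 ·e i) j) (seqSum-replicate (y i) (p ·e i) j) ⟩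
      x i * (1 ·e i) j + y i * (p ·e i) j      ≡⟨ cong₂ _+_ (*-·e (x i) 1 i j) (*-·e (y i) p i j) ⟩
      (x i * 1 ·e i) j + (y i * p ·e i) j      ≡⟨ +-·e (x i * 1) (y i * p) i j ⟩
      (x i * 1 + y i * p ·e i) j               ∎

  basisSeq-positive : 0 < p → All HasPositiveCoordinate basisSeq
  basisSeq-positive 0<p = concat⁺ (tabulate⁺ λ i →
    ++⁺ (replicate⁺ (x i) (i , subst (0 <_) (sym (·e-self 1 i)) (s≤s z≤n)))
        (replicate⁺ (y i) (i , subst (0 <_) (sym (·e-self p i)) 0<p)))

  module _ (a : Fin r → ℕ) (0<p : 0 < p) (x+y*p<p^a : ∀ j → x j + y j * p < p ^ a j) where

    seqSum-basisSeq-< : ∀ j → seqSum basisSeq j < p ^ a j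
    seqSum-basisSeq-< j = subst (_< p ^ a j) (sym (seqSum-basisSeq j)) (x+y*p<p^a j)

    basisSeq-InG : ∀ {g} → g ∈ basisSeq → InG p a g
    basisSeq-InG g∈S j = ≤-<-trans (∈⇒≤seqSum j g∈S) (seqSum-basisSeq-< j)

    basisSeq-zeroSumFree : ZeroSumFree p a basisSeq
    basisSeq-zeroSumFree = positive-bounded⇒ZeroSumFree p a (basisSeq-positive 0<p) seqSum-basisSeq-<

  module _ (a : Fin r → ℕ) (A : ℕ) (1<p : 1 < p) (1≤A : 1 ≤ A) (a≤A : ∀ i → a i ≤ A) where

    private
      maxOrder? = hasOrder? p a (p ^ A)

    maxOrderCount-basisBlock : ∀ i →
      length (filter maxOrder? (basisBlock i)) ≡ length (filter maxOrder? (replicate (x i) (1 ·e i)))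
    maxOrderCount-basisBlock i =
      trans (length-filter-++ maxOrder? ones (replicate (y i) (p ·e i)))
            (trans (cong (λ T → length (filter maxOrder? ones) + length T) no-p·e) (+-identityʳ _))
      where
      ones = replicate (x i) (1 ·e i)
      no-p·e : filter maxOrder? (replicate (y i) (p ·e i)) ≡ []
      no-p·e = filter-none maxOrder? (replicate⁺ (y i) (·e-¬HasOrder a i 1<p 1≤A
        (subst (p ^ a i ∣_) (sym (^-pred p 1≤A)) (^-monoʳ-∣ p (a≤A i)))))

    maxOrderCount-basisBlock-≤ : ∀ i → length (filter maxOrder? (basisBlock i)) ≤ x i
    maxOrderCount-basisBlock-≤ i = begin
      length (filter maxOrder? (basisBlock i))  ≡⟨ maxOrderCount-basisBlock i ⟩
      length (filter maxOrder? ones)            ≤⟨ length-filter maxOrder? ones ⟩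
      length ones                               ≡⟨ length-replicate (x i) ⟩
      x i                                       ∎
      where
      open ≤-Reasoning
      ones = replicate (x i) (1 ·e i)

    maxOrderCount-basisBlock-low : ∀ i → a i < A → length (filter maxOrder? (basisBlock i)) ≡ 0
    maxOrderCount-basisBlock-low i a<A = trans (maxOrderCount-basisBlock i)
      (cong length (filter-none maxOrder? (replicate⁺ (x i) (·e-¬HasOrder a i 1<p 1≤A
        (subst (p ^ a i ∣_) (sym (*-identityʳ _)) (^-monoʳ-∣ p (<⇒≤pred a<A)))))))

m*[n∸1]+[m∸1]≡m*n∸1 : ∀ m n .{{_ : NonZero m}} .{{_ : NonZero n}} → m * (n ∸ 1) + (m ∸ 1) ≡ m * n ∸ 1
m*[n∸1]+[m∸1]≡m*n∸1 (suc w) (suc q) = identity w q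
  where
  identity : ∀ w q → suc w * q + w ≡ q + w * suc q
  identity = solve-∀

module Allocation (w Q k δ : ℕ) .{{_ : NonZero w}} .{{_ : NonZero k}} where

  f : ℕ
  f = (δ / w) ⊓ (k * Q)

  R : ℕ
  R = δ ∸ w * f

  w*f+R≡δ : w * f + R ≡ δ
  w*f+R≡δ = m+[n∸m]≡n (≤-trans (*-monoʳ-≤ w (m⊓n≤m (δ / w) (k * Q)))
                                (subst (_≤ δ) (*-comm (δ / w) w) (m/n*n≤m δ w)))

  saturated : k * w < R → f ≡ k * Q
  saturated kw<R with ≤-total (δ / w) (k * Q)
  ... | inj₂ kQ≤δ/w = m≥n⇒m⊓n≡n kQ≤δ/w
  ... | inj₁ δ/w≤kQ = ⊥-elim (<⇒≱ kw<R (≤-trans (<⇒≤ R<w) (m≤n*m w k)))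
    where
    R<w : R < w
    R<w = subst (_< w) (begin
      δ % w               ≡⟨ m%n≡m∸m/n*n δ w ⟩
      δ ∸ δ / w * w       ≡⟨ cong (δ ∸_) (*-comm (δ / w) w) ⟩
      δ ∸ w * (δ / w)     ≡⟨ cong (λ t → δ ∸ w * t) (sym (m≤n⇒m⊓n≡m δ/w≤kQ)) ⟩
      R                   ∎) (m%n<n δ w)
      where open ≡-Reasoning

  count-bound : ∀ C → C + (suc w * f + R ⊓ (k * w)) ≡ k * (suc w * Q + w) →
                C ≤ k * (suc w * Q + w) ∸ δ ∸ f
  count-bound C eq with R ≤? k * w
  ... | yes R≤kw = ≤-reflexive (sym (begin
    k * (suc w * Q + w) ∸ δ ∸ f ≡⟨ ∸-+-assoc (k * (suc w * Q + w)) δ f ⟩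
    k * (suc w * Q + w) ∸ (δ + f) ≡⟨ cong₂ _∸_ (sym eq) δ+f≡ ⟩
    C + (suc w * f + R ⊓ (k * w)) ∸ (suc w * f + R ⊓ (k * w)) ≡⟨ m+n∸n≡m C (suc w * f + R ⊓ (k * w)) ⟩
    C ∎))
    where
    open ≡-Reasoning
    δ+f≡ : δ + f ≡ suc w * f + R ⊓ (k * w)
    δ+f≡ = begin
      δ + f                 ≡⟨ cong (_+ f) (sym w*f+R≡δ) ⟩
      w * f + R + f         ≡⟨ +-comm (w * f + R) f ⟩
      f + (w * f + R)       ≡⟨ sym (+-assoc f (w * f) R) ⟩
      suc w * f + R         ≡⟨ cong (suc w * f +_) (sym (m≤n⇒m⊓n≡m R≤kw)) ⟩
      suc w * f + R ⊓ (k * w) ∎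
  ... | no R≰kw = subst (_≤ _) (sym C≡0) z≤n
    where
    kw<R = ≰⇒> R≰kw
    expand : ∀ k w Q → k * (suc w * Q + w) ≡ 0 + (suc w * (k * Q) + k * w)
    expand = solve-∀
    C≡0 : C ≡ 0
    C≡0 = +-cancelʳ-≡ _ C 0 (trans
      (cong₂ (λ u v → C + (suc w * u + v)) (sym (saturated kw<R)) (sym (m≥n⇒m⊓n≡n (<⇒≤ kw<R))))
      (trans eq (expand k w Q)))

module TopBlockConstruction
  (p′ n : ℕ) (a : Fin (suc n) → ℕ) (a≥1 : ∀ i → 1 ≤ a i)
  (mono : ∀ i j → i Data.Fin.≤ j → a i ≤ a j) (δ : ℕ) (j0 : Fin (suc n))
  (a[j0]≡A : a j0 ≡ a (fromℕ n)) (j0-least : ∀ i → a i ≡ a (fromℕ n) → j0 Data.Fin.≤ i) where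

  w p A Q N k : ℕ
  w = suc p′
  p = suc w
  A = a (fromℕ n)
  Q = p ^ (A ∸ 1) ∸ 1
  N = p ^ A ∸ 1
  k = suc n ∸ toℕ j0

  instance
    k≢0 : NonZero k
    k≢0 = >-nonZero (m<n⇒0<n∸m (toℕ<n j0))

  open Allocation w Q k δ

  top : Fin (suc n) → ℕ
  top i = 𝟙[ toℕ j0 ≤ toℕ i ]

  y z x : Fin (suc n) → ℕ
  y = fill (λ i → top i * Q) (δ / w)
  z = fill (λ i → top i * w) R
  x i = (p ^ a i ∸ 1) ∸ (p * y i + z i)

  S : List (Elem (suc n))
  S = basisSeq p x y

  1<p : 1 < p
  1<p = s≤s (s≤s z≤n)

  1≤A : 1 ≤ A
  1≤A = a≥1 (fromℕ n)

  a≤A : ∀ i → a i ≤ A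
  a≤A i = mono i (fromℕ n) (≤fromℕ i)

  p*Q+w≡N : p * Q + w ≡ N
  p*Q+w≡N = trans (m*[n∸1]+[m∸1]≡m*n∸1 p (p ^ (A ∸ 1)) {{_}} {{m^n≢0 p (A ∸ 1)}})
                  (cong (_∸ 1) (trans (*-comm p (p ^ (A ∸ 1))) (^-pred p 1≤A)))

  ∑-top-* : ∀ c → ∑ (λ i → top i * c) ≡ k * c
  ∑-top-* c = trans (sym (*-distribʳ-sum c top)) (cong (_* c) (∑-𝟙≤ (suc n) (toℕ j0)))

  ∑y≡f : ∑ y ≡ f
  ∑y≡f = trans (∑-fill (λ i → top i * Q) (δ / w)) (cong ((δ / w) ⊓_) (∑-top-* Q))

  ∑z≡R⊓kw : ∑ z ≡ R ⊓ (k * w)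
  ∑z≡R⊓kw = trans (∑-fill (λ i → top i * w) R) (cong (R ⊓_) (∑-top-* w))

  position : ∀ i → (top i ≡ 1 × a i ≡ A × y i ≤ Q × z i ≤ w)
                 ⊎ (top i ≡ 0 × a i < A × y i ≡ 0 × z i ≡ 0)
  position i with 𝟙≤-cases (toℕ j0) (toℕ i)
  ... | inj₁ (top≡1 , j0≤i) = inj₁ (top≡1
    , ≤-antisym (a≤A i) (subst (_≤ a i) a[j0]≡A (mono j0 i j0≤i))
    , ≤-trans (fill-≤ (λ i → top i * Q) (δ / w) i) (≤-reflexive (trans (cong (_* Q) top≡1) (*-identityˡ Q)))
    , ≤-trans (fill-≤ (λ i → top i * w) R i) (≤-reflexive (trans (cong (_* w) top≡1) (*-identityˡ w))))
  ... | inj₂ (top≡0 , i<j0) = inj₂ (top≡0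
    , ≤∧≢⇒< (a≤A i) (λ a≡A → <⇒≱ i<j0 (j0-least i a≡A))
    , n≤0⇒n≡0 (subst (y i ≤_) (cong (_* Q) top≡0) (fill-≤ (λ i → top i * Q) (δ / w) i))
    , n≤0⇒n≡0 (subst (z i ≤_) (cong (_* w) top≡0) (fill-≤ (λ i → top i * w) R i)))

  p*y+z≤p^a∸1 : ∀ i → p * y i + z i ≤ p ^ a i ∸ 1
  p*y+z≤p^a∸1 i with position i
  ... | inj₁ (_ , a≡A , y≤Q , z≤w) = begin
    p * y i + z i   ≤⟨ +-mono-≤ (*-monoʳ-≤ p y≤Q) z≤w ⟩
    p * Q + w       ≡⟨ p*Q+w≡N ⟩
    N               ≡⟨ cong (λ t → p ^ t ∸ 1) (sym a≡A) ⟩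
    p ^ a i ∸ 1     ∎
    where open ≤-Reasoning
  ... | inj₂ (_ , _ , y≡0 , z≡0) rewrite y≡0 | z≡0 | *-zeroʳ p = z≤n

  x+[p*y+z]≡p^a∸1 : ∀ i → x i + (p * y i + z i) ≡ p ^ a i ∸ 1
  x+[p*y+z]≡p^a∸1 i = m∸n+n≡m (p*y+z≤p^a∸1 i)

  x+y*p<p^a : ∀ j → x j + y j * p < p ^ a j
  x+y*p<p^a j = m≤pred[n]⇒suc[m]≤n {{m^n≢0 p (a j)}} (begin
    x j + y j * p           ≡⟨ cong (x j +_) (*-comm (y j) p) ⟩
    x j + p * y j           ≤⟨ +-monoʳ-≤ (x j) (m≤m+n (p * y j) (z j)) ⟩
    x j + (p * y j + z j)   ≡⟨ x+[p*y+z]≡p^a∸1 j ⟩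
    p ^ a j ∸ 1             ∎)
    where open ≤-Reasoning

  davenport≤δ+|S| : davenport p a ≤ δ + length S
  davenport≤δ+|S| = begin
    davenport p a                                   ≡⟨ sumFin≡∑ (λ i → p ^ a i ∸ 1) ⟩
    ∑ (λ i → p ^ a i ∸ 1)                           ≡⟨ sum-cong-≗ regrouped ⟩
    ∑ (λ i → (x i + y i) + (w * y i + z i))         ≡⟨ ∑-distrib-+ (λ i → x i + y i) (λ i → w * y i + z i) ⟩
    ∑ (λ i → x i + y i) + ∑ (λ i → w * y i + z i)   ≡⟨ cong (∑ (λ i → x i + y i) +_) ∑[w*y+z]≡ ⟩
    ∑ (λ i → x i + y i) + (w * f + ∑ z)             ≤⟨ +-monoʳ-≤ (∑ (λ i → x i + y i)) (+-monoʳ-≤ (w * f) ∑z≤R) ⟩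
    ∑ (λ i → x i + y i) + (w * f + R)               ≡⟨ cong₂ _+_ (sym (length-basisSeq p x y)) w*f+R≡δ ⟩
    length S + δ                                    ≡⟨ +-comm (length S) δ ⟩
    δ + length S                                    ∎
    where
    open ≤-Reasoning
    ∑z≤R : ∑ z ≤ R
    ∑z≤R = subst (_≤ R) (sym ∑z≡R⊓kw) (m⊓n≤m R (k * w))
    regroup : ∀ x y w z → x + (suc w * y + z) ≡ (x + y) + (w * y + z)
    regroup = solve-∀
    regrouped : ∀ i → p ^ a i ∸ 1 ≡ (x i + y i) + (w * y i + z i)
    regrouped i = trans (sym (x+[p*y+z]≡p^a∸1 i)) (regroup (x i) (y i) w (z i))
    ∑[w*y+z]≡ : ∑ (λ i → w * y i + z i) ≡ w * f + ∑ z
    ∑[w*y+z]≡ = trans (∑-distrib-+ (λ i → w * y i) z)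
                      (cong (_+ ∑ z) (trans (sym (*-distribˡ-sum w y)) (cong (w *_) ∑y≡f)))

  top*x+[p*y+z]≡top*N : ∀ i → top i * x i + (p * y i + z i) ≡ top i * N
  top*x+[p*y+z]≡top*N i with position i
  ... | inj₁ (top≡1 , a≡A , _) rewrite top≡1 | *-identityˡ (x i) | *-identityˡ N =
    trans (x+[p*y+z]≡p^a∸1 i) (cong (λ t → p ^ t ∸ 1) a≡A)
  ... | inj₂ (top≡0 , _ , y≡0 , z≡0) rewrite top≡0 | y≡0 | z≡0 = trans (+-identityʳ (p * 0)) (*-zeroʳ p)

  ∑top*x+[p*f+R⊓kw]≡k*[p*Q+w] : ∑ (λ i → top i * x i) + (p * f + R ⊓ (k * w)) ≡ k * (p * Q + w)
  ∑top*x+[p*f+R⊓kw]≡k*[p*Q+w] = begin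
    C + (p * f + R ⊓ (k * w))                 ≡⟨ cong₂ (λ u v → C + (p * u + v)) (sym ∑y≡f) (sym ∑z≡R⊓kw) ⟩
    C + (p * ∑ y + ∑ z)                       ≡⟨ cong (λ t → C + (t + ∑ z)) (*-distribˡ-sum p y) ⟩
    C + (∑ (λ i → p * y i) + ∑ z)             ≡⟨ cong (C +_) (sym (∑-distrib-+ (λ i → p * y i) z)) ⟩
    C + ∑ (λ i → p * y i + z i)               ≡⟨ sym (∑-distrib-+ (λ i → top i * x i) (λ i → p * y i + z i)) ⟩
    ∑ (λ i → top i * x i + (p * y i + z i))   ≡⟨ sum-cong-≗ top*x+[p*y+z]≡top*N ⟩
    ∑ (λ i → top i * N)                       ≡⟨ ∑-top-* N ⟩
    k * N                                     ≡⟨ cong (k *_) (sym p*Q+w≡N) ⟩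
    k * (p * Q + w)                           ∎
    where
    open ≡-Reasoning
    C = ∑ (λ i → top i * x i)

  numMaxOrder≤∑top*x : numMaxOrder p a S ≤ ∑ (λ i → top i * x i)
  numMaxOrder≤∑top*x = begin
    numMaxOrder p a S                               ≡⟨ concat-tabulate-additive (length ∘ filter maxOrder?) refl
                                                         (length-filter-++ maxOrder?) (basisBlock p x y) ⟩
    ∑ (λ i → length (filter maxOrder? (basisBlock p x y i))) ≤⟨ ∑-mono-≤ block≤ ⟩
    ∑ (λ i → top i * x i)                           ∎
    where
    open ≤-Reasoning
    maxOrder? = hasOrder? p a (p ^ A)
    block≤ : ∀ i → length (filter maxOrder? (basisBlock p x y i)) ≤ top i * x i
    block≤ i with position i
    ... | inj₁ (top≡1 , _) rewrite top≡1 | *-identityˡ (x i) =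
      maxOrderCount-basisBlock-≤ p x y a A 1<p 1≤A a≤A i
    ... | inj₂ (top≡0 , a<A , _) rewrite top≡0 =
      ≤-reflexive (maxOrderCount-basisBlock-low p x y a A 1<p 1≤A a≤A i a<A)

  witness : ΓLe p a δ (k * N ∸ δ ∸ f)
  witness = S
          , basisSeq-InG p x y a (s≤s z≤n) x+y*p<p^a
          , basisSeq-zeroSumFree p x y a (s≤s z≤n) x+y*p<p^a
          , m≤n+o⇒m∸n≤o (davenport p a) δ davenport≤δ+|S| , maxOrderCount-bound
    where
    maxOrderCount-bound : numMaxOrder p a S ≤ k * N ∸ δ ∸ f
    maxOrderCount-bound = begin
      numMaxOrder p a S         ≤⟨ numMaxOrder≤∑top*x ⟩
      ∑ (λ i → top i * x i)     ≤⟨ count-bound (∑ (λ i → top i * x i)) ∑top*x+[p*f+R⊓kw]≡k*[p*Q+w] ⟩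
      k * (p * Q + w) ∸ δ ∸ f   ≡⟨ cong (λ t → k * t ∸ δ ∸ f) p*Q+w≡N ⟩
      k * N ∸ δ ∸ f             ∎
      where open ≤-Reasoning

proposition4p1 : (p : ℕ) (pr : Prime p) (n : ℕ) (a : Fin (suc n) → ℕ)
    → (∀ i → 1 Data.Nat.≤ a i)
    → (∀ i j → i Data.Fin.≤ j → a i Data.Nat.≤ a j)
    → (δ : ℕ) → δ Data.Nat.≤ davenport p a ∸ 1
    → (j0 : Fin (suc n)) → a j0 ≡ a (fromℕ n)
    → (∀ i → a i ≡ a (fromℕ n) → j0 Data.Fin.≤ i)
    → ΓLe p a δ
        ((suc n ∸ toℕ j0) * (p ^ a (fromℕ n) ∸ 1) ∸ δ
          ∸ (divPred pr δ ⊓ ((suc n ∸ toℕ j0) * (p ^ (a (fromℕ n) ∸ 1) ∸ 1))))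
proposition4p1 0 pr = ⊥-elim (¬prime[0] pr)
proposition4p1 1 pr = ⊥-elim (¬prime[1] pr)
proposition4p1 (suc (suc p′)) _ n a a≥1 mono δ _ j0 a[j0]≡A j0-least =
  TopBlockConstruction.witness p′ n a a≥1 mono δ j0 a[j0]≡A j0-least
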